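{- Let $\mathcal P$ be a set of formulas and let $\mathcal I$ be a stable set of formulas such that $\mathcal I\cap\mathcal P=\emptyset$ and $\perp\notin\mathcal I$. If $\Gamma$ is a finite multiset of formulas of $\mathcal I$ and $A\in\mathcal I$, then $\Gamma\vdash_{\mathcal P} ;A$ (with empty body) if and only if $\Gamma\vdash_{\mathrm{LJ}} A$.
   Context: Formulas are given by the grammar $F ::= 0 \mid \perp \mid X \mid F\wedge F \mid F\vee F \mid F\rightarrow F$, where $X$ ranges over a set $\mathcal V$ of propositional variables and $0$, $\perp$ are two distinct constants. A set $\mathcal S$ of formulas is stable if for every $c\in\{\wedge,\vee,\rightarrow\}$, $A\,c\,B\in\mathcal S$ implies $A,B\in\mathcal S$. $\mathrm{LJ}$ denotes Gentzen's intuitionistic propositional sequent calculus over formulas built from the variables $\mathcal V$ and the constant $0$ with $\wedge,\vee,\rightarrow$, where $0$ is the absurdity (with the rule $\Gamma,0\vdash C$); $\Gamma\vdash_{\mathrm{LJ}}A$ means the sequent is derivable in LJ. Fix a set $\mathcal P$ of formulas. A $\mathcal P$-sequent is an expression $\Gamma\vdash\Delta;\Pi$ where $\Gamma,\Delta,\Pi$ are finite multisets of formulas, every formula of $\Delta$ (the body) belongs to $\mathcal P$, and $\Pi$ (the stoup) contains at most one formula. The system $\mathrm{ML}_{\mathcal P}$ derives $\mathcal P$-sequents with the following rules (below $C$ denotes a single formula, $\Pi$ a stoup with at most one formula, and all sequents must be $\mathcal P$-sequents): Axiom/cuts: $ax$: $A\vdash ;A$. $cut_1$: from $\Gamma\vdash\Delta;A$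 and $\Gamma',A\vdash\Delta';\Pi$ infer $\Gamma,\Gamma'\vdash\Delta,\Delta';\Pi$. $cut_2$: from $\Gamma\vdash\Delta,A;\Pi$ and $\Gamma',A\vdash\Delta';$ infer $\Gamma,\Gamma'\vdash\Delta,\Delta';\Pi$. Structure: $der$: from $\Gamma\vdash\Delta;A$ with $A\in\mathcal P$ infer $\Gamma\vdash\Delta,A;$. $c_l$: from $\Gamma,A,A\vdash\Delta;\Pi$ infer $\Gamma,A\vdash\Delta;\Pi$. $c_r$: from $\Gamma\vdash\Delta,A,A;\Pi$ infer $\Gamma\vdash\Delta,A;\Pi$. $w_l$: from $\Gamma\vdash\Delta;\Pi$ infer $\Gamma,A\vdash\Delta;\Pi$. $w_r$: from $\Gamma\vdash\Delta;\Pi$ with $A\in\mathcal P$ infer $\Gamma\vdash\Delta,A;\Pi$. Logic: $0$: $\Gamma,0\vdash\Delta;\Pi$ (any $\Delta\subseteq\mathcal P$). $\perp$: $\perp\vdash ;$. $\wedge^1_l$: from $\Gamma,A,B\vdash\Delta;C$ with $A\notin\mathcal P$ and $B\notin\mathcal P$ infer $\Gamma,A\wedge B\vdash\Delta;C$. $\wedge^2_l$: from $\Gamma,A,B\vdash\Delta;$ infer $\Gamma,A\wedge B\vdash\Delta;$. $\wedge^1_r$: from $\Gamma\vdash\Delta;A$ and $\Gamma'\vdash\Delta';B$ infer $\Gamma,\Gamma'\vdash\Delta,\Delta';A\wedge B$. $\wedge^2_r$: from $\Gamma\vdash\Delta,A;$ and $\Gamma'\vdash\Delta',B;$ infer the same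 conclusion. $\wedge^3_r$: from $\Gamma\vdash\Delta;A$ and $\Gamma'\vdash\Delta',B;$ infer the same conclusion. $\wedge^4_r$: from $\Gamma\vdash\Delta,A;$ and $\Gamma'\vdash\Delta';B$ infer the same conclusion. $\vee^1_l$: from $\Gamma,A\vdash\Delta;C$ and $\Gamma,B\vdash\Delta;C$ with $A\notin\mathcal P$ and $B\notin\mathcal P$ infer $\Gamma,A\vee B\vdash\Delta;C$. $\vee^2_l$: from $\Gamma,A\vdash\Delta;$ and $\Gamma,B\vdash\Delta;$ infer $\Gamma,A\vee B\vdash\Delta;$. $\vee^1_r$: from $\Gamma\vdash\Delta;A$ infer $\Gamma\vdash\Delta;A\vee B$. $\vee^2_r$: from $\Gamma\vdash\Delta;B$ infer $\Gamma\vdash\Delta;A\vee B$. $\vee^3_r$: from $\Gamma\vdash\Delta,A;$ infer $\Gamma\vdash\Delta;A\vee B$. $\vee^4_r$: from $\Gamma\vdash\Delta,B;$ infer $\Gamma\vdash\Delta;A\vee B$. $\rightarrow^1_l$: from $\Gamma,B\vdash\Delta;C$ and $\Gamma'\vdash\Delta';A$ with $B\notin\mathcal P$ infer $\Gamma,\Gamma',A\rightarrow B\vdash\Delta,\Delta';C$. $\rightarrow^2_l$: from $\Gamma,B\vdash\Delta;$ and $\Gamma'\vdash\Delta';A$ infer $\Gamma,\Gamma',A\rightarrow B\vdash\Delta,\Delta';$. $\rightarrow^3_l$: from $\Gamma,B\vdash\Delta;$ and $\Gamma'\vdash\Delta',A;\Pi$ infer $\Gamma,\Gamma',A\rightarrow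 B\vdash\Delta,\Delta';\Pi$. $\rightarrow^1_r$: from $\Gamma,A\vdash\Delta;B$ infer $\Gamma\vdash\Delta;A\rightarrow B$. $\rightarrow^2_r$: from $\Gamma,A\vdash\Delta,B;$ infer $\Gamma\vdash\Delta;A\rightarrow B$. One writes $\Gamma\vdash_{\mathcal P}\Delta;\Pi$ when the $\mathcal P$-sequent $\Gamma\vdash\Delta;\Pi$ is derivable in $\mathrm{ML}_{\mathcal P}$. -}

module Defs where

open import Data.List using (List; []; _∷_; [_]; _++_)
open import Data.List.Relation.Unary.All using (All)
open import Data.List.Relation.Binary.Permutation.Propositional using (_↭_)
open import Data.Maybe using (Maybe; just; nothing)
open import Relation.Nullary using (¬_)

infixr 6 _∧_
infixr 5 _∨_
infixr 4 _⇒_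

-- Formulas over a set V of propositional variables, with two distinct constants
-- 𝟎 (absurdity "0") and ⊥ (the constant "⊥" of the paper).
data Formula (V : Set) : Set where
  𝟎   : Formula V
  ⊥   : Formula V
  var : V → Formula V
  _∧_ : Formula V → Formula V → Formula V
  _∨_ : Formula V → Formula V → Formula V
  _⇒_ : Formula V → Formula V → Formula V

Stable : {V : Set} → (Formula V → Set) → Set
Stable {V} S =
  (∀ {A B : Formula V} → S (A ∧ B) → S A × S B) ×
  (∀ {A B : Formula V} → S (A ∨ B) → S A × S B) ×
  (∀ {A B : Formula V} → S (A ⇒ B) → S A × S B)
  where open import Data.Product using (_×_)

data BotFree {V : Set} : Formula V → Set where
  bf-𝟎   : BotFree 𝟎
  bf-var : ∀ x → BotFree (var x)
  bf-∧   : ∀ {A B} → BotFree A → BotFree B → BotFree (A ∧ B)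
  bf-∨   : ∀ {A B} → BotFree A → BotFree B → BotFree (A ∨ B)
  bf-⇒   : ∀ {A B} → BotFree A → BotFree B → BotFree (A ⇒ B)

-- Gentzen's LJ (single succedent, 0 as absurdity), multisets as lists + exchange.
-- Cut formulas are required to be ⊥-free, so that every derivation of a ⊥-free
-- end-sequent only mentions LJ formulas (subformula property of all other rules).
data LJ {V : Set} : List (Formula V) → Formula V → Set where
  ax    : ∀ {A} → LJ [ A ] A
  cut   : ∀ {Γ Γ' A C} → BotFree A → LJ Γ A → LJ (A ∷ Γ') C → LJ (Γ ++ Γ') C
  exch  : ∀ {Γ Γ' C} → Γ ↭ Γ' → LJ Γ C → LJ Γ' C
  wl    : ∀ {Γ A C} → LJ Γ C → LJ (A ∷ Γ) C
  cl    : ∀ {Γ A C} → LJ (A ∷ A ∷ Γ) C → LJ (A ∷ Γ) C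
  zl    : ∀ {Γ C} → LJ (𝟎 ∷ Γ) C
  ∧l₁   : ∀ {Γ A B C} → LJ (A ∷ Γ) C → LJ ((A ∧ B) ∷ Γ) C
  ∧l₂   : ∀ {Γ A B C} → LJ (B ∷ Γ) C → LJ ((A ∧ B) ∷ Γ) C
  ∧r    : ∀ {Γ A B} → LJ Γ A → LJ Γ B → LJ Γ (A ∧ B)
  ∨l    : ∀ {Γ A B C} → LJ (A ∷ Γ) C → LJ (B ∷ Γ) C → LJ ((A ∨ B) ∷ Γ) C
  ∨r₁   : ∀ {Γ A B} → LJ Γ A → LJ Γ (A ∨ B)
  ∨r₂   : ∀ {Γ A B} → LJ Γ B → LJ Γ (A ∨ B)
  ⇒l    : ∀ {Γ Γ' A B C} → LJ Γ A → LJ (B ∷ Γ') C → LJ ((A ⇒ B) ∷ Γ ++ Γ') C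
  ⇒r    : ∀ {Γ A B} → LJ (A ∷ Γ) B → LJ Γ (A ⇒ B)

-- ML P Γ Δ Π  is the P-sequent  Γ ⊢ Δ ; Π  (Π : stoup, at most
-- one formula).  "Γ, A" is written  A ∷ Γ ; multisets are lists modulo the
-- exchange rule  exch .  Every derivable sequent is a P-sequent: the only rules
-- putting new formulas in the body (der, w_r, 0) require them to be in P.
data ML {V : Set} (P : Formula V → Set)
  : List (Formula V) → List (Formula V) → Maybe (Formula V) → Set where
  ax   : ∀ {A} → ML P [ A ] [] (just A)
  cut₁ : ∀ {Γ Γ' Δ Δ' A Π} → ML P Γ Δ (just A) → ML P (A ∷ Γ') Δ' Π
       → ML P (Γ ++ Γ') (Δ ++ Δ') Π
  cut₂ : ∀ {Γ Γ' Δ Δ' A Π} → ML P Γ (A ∷ Δ) Π → ML P (A ∷ Γ') Δ' nothing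
       → ML P (Γ ++ Γ') (Δ ++ Δ') Π
  exch : ∀ {Γ Γ' Δ Δ' Π} → Γ ↭ Γ' → Δ ↭ Δ' → ML P Γ Δ Π → ML P Γ' Δ' Π
  der  : ∀ {Γ Δ A} → P A → ML P Γ Δ (just A) → ML P Γ (A ∷ Δ) nothing
  cl   : ∀ {Γ Δ A Π} → ML P (A ∷ A ∷ Γ) Δ Π → ML P (A ∷ Γ) Δ Π
  cr   : ∀ {Γ Δ A Π} → ML P Γ (A ∷ A ∷ Δ) Π → ML P Γ (A ∷ Δ) Π
  wl   : ∀ {Γ Δ A Π} → ML P Γ Δ Π → ML P (A ∷ Γ) Δ Π
  wr   : ∀ {Γ Δ A Π} → P A → ML P Γ Δ Π → ML P Γ (A ∷ Δ) Π
  zl   : ∀ {Γ Δ Π} → All P Δ → ML P (𝟎 ∷ Γ) Δ Π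
  botl : ML P [ ⊥ ] [] nothing
  ∧l₁  : ∀ {Γ Δ A B C} → ¬ P A → ¬ P B → ML P (A ∷ B ∷ Γ) Δ (just C)
       → ML P ((A ∧ B) ∷ Γ) Δ (just C)
  ∧l₂  : ∀ {Γ Δ A B} → ML P (A ∷ B ∷ Γ) Δ nothing → ML P ((A ∧ B) ∷ Γ) Δ nothing
  ∧r₁  : ∀ {Γ Γ' Δ Δ' A B} → ML P Γ Δ (just A) → ML P Γ' Δ' (just B)
       → ML P (Γ ++ Γ') (Δ ++ Δ') (just (A ∧ B))
  ∧r₂  : ∀ {Γ Γ' Δ Δ' A B} → ML P Γ (A ∷ Δ) nothing → ML P Γ' (B ∷ Δ') nothing
       → ML P (Γ ++ Γ') (Δ ++ Δ') (just (A ∧ B))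
  ∧r₃  : ∀ {Γ Γ' Δ Δ' A B} → ML P Γ Δ (just A) → ML P Γ' (B ∷ Δ') nothing
       → ML P (Γ ++ Γ') (Δ ++ Δ') (just (A ∧ B))
  ∧r₄  : ∀ {Γ Γ' Δ Δ' A B} → ML P Γ (A ∷ Δ) nothing → ML P Γ' Δ' (just B)
       → ML P (Γ ++ Γ') (Δ ++ Δ') (just (A ∧ B))
  ∨l₁  : ∀ {Γ Δ A B C} → ¬ P A → ¬ P B → ML P (A ∷ Γ) Δ (just C)
       → ML P (B ∷ Γ) Δ (just C) → ML P ((A ∨ B) ∷ Γ) Δ (just C)
  ∨l₂  : ∀ {Γ Δ A B} → ML P (A ∷ Γ) Δ nothing → ML P (B ∷ Γ) Δ nothing
       → ML P ((A ∨ B) ∷ Γ) Δ nothing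
  ∨r₁  : ∀ {Γ Δ A B} → ML P Γ Δ (just A) → ML P Γ Δ (just (A ∨ B))
  ∨r₂  : ∀ {Γ Δ A B} → ML P Γ Δ (just B) → ML P Γ Δ (just (A ∨ B))
  ∨r₃  : ∀ {Γ Δ A B} → ML P Γ (A ∷ Δ) nothing → ML P Γ Δ (just (A ∨ B))
  ∨r₄  : ∀ {Γ Δ A B} → ML P Γ (B ∷ Δ) nothing → ML P Γ Δ (just (A ∨ B))
  ⇒l₁  : ∀ {Γ Γ' Δ Δ' A B C} → ¬ P B → ML P (B ∷ Γ) Δ (just C)
       → ML P Γ' Δ' (just A) → ML P ((A ⇒ B) ∷ Γ ++ Γ') (Δ ++ Δ') (just C)
  ⇒l₂  : ∀ {Γ Γ' Δ Δ' A B} → ML P (B ∷ Γ) Δ nothing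
       → ML P Γ' Δ' (just A) → ML P ((A ⇒ B) ∷ Γ ++ Γ') (Δ ++ Δ') nothing
  ⇒l₃  : ∀ {Γ Γ' Δ Δ' A B Π} → ML P (B ∷ Γ) Δ nothing
       → ML P Γ' (A ∷ Δ') Π → ML P ((A ⇒ B) ∷ Γ ++ Γ') (Δ ++ Δ') Π
  ⇒r₁  : ∀ {Γ Δ A B} → ML P (A ∷ Γ) Δ (just B) → ML P Γ Δ (just (A ⇒ B))
  ⇒r₂  : ∀ {Γ Δ A B} → ML P (A ∷ Γ) (B ∷ Δ) nothing → ML P Γ Δ (just (A ⇒ B))

-- Both sides are compared with a cut-free calculus ⊢ᶜᶠ, by normalisation by
-- evaluation.  ML_Q is sound for a Kripke–Beth model whose worlds are contexts,
-- whose covers are built from left rules, and in which a subformula lying in Q is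
-- only known up to double negation (relative to covers with no leaves).  On a
-- stable set I that avoids Q and ⊥ the model reifies into cut-free derivations,
-- so every ML_Q-derivation of an I-sequent normalises to a ⊢ᶜᶠ-derivation.
-- Cut-free derivations of I-sequents translate rule by rule into LJ, and also
-- into ML_P, since their left rules decompose only subformulas in I, hence not
-- in P.  Finally LJ embeds into ML_∅, which normalises as well.

module Submission where

open import Defs
open import Data.Empty using (⊥-elim) renaming (⊥ to Empty)
open import Data.List using (List; []; _∷_; _++_)
open import Data.List.Membership.Propositional using (_∈_)
open import Data.List.Membership.Propositional.Properties using (∈-∃++; ∈-++⁺ʳ)
open import Data.List.Relation.Binary.Permutation.Propositional
  using (_↭_; prep; swap; ↭-refl; ↭-sym)
open import Data.List.Relation.Binary.Permutation.Propositional.Properties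
  using (shift; ++-comm; All-resp-↭)
open import Data.List.Relation.Binary.Subset.Propositional using (_⊆_)
open import Data.List.Relation.Binary.Subset.Propositional.Properties
  using (⊆-refl; ⊆-trans; ∷⁺ʳ; xs⊆x∷xs; ∈-∷⁺ʳ)
open import Data.List.Relation.Unary.All using (All; []; _∷_; head; tail; tabulate; lookup)
import Data.List.Relation.Unary.All as All
open import Data.List.Relation.Unary.All.Properties using (++⁺; ++⁻)
open import Data.List.Relation.Unary.Any using (here; there)
open import Data.Maybe using (Maybe; just; nothing)
open import Data.Product using (_×_; _,_; proj₁; proj₂)
open import Data.Sum using (_⊎_; inj₁; inj₂)
open import Function using (_∘_)
open import Function.Bundles using (_⇔_; mk⇔)
open import Relation.Nullary using (¬_)
open import Relation.Unary using (∅)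
open import Relation.Binary.PropositionalEquality using (refl)

Ctx : Set → Set
Ctx V = List (Formula V)

private
  variable
    V : Set
    A B C : Formula V
    Γ Δ W : Ctx V
    Π : Maybe (Formula V)

module Structural (D : Ctx V → Set)
  (exchange : ∀ {Γ Γ'} → Γ ↭ Γ' → D Γ → D Γ')
  (weaken : ∀ {A Γ} → D Γ → D (A ∷ Γ))
  (contract : ∀ {A Γ} → D (A ∷ A ∷ Γ) → D (A ∷ Γ)) where

  contract-∈ : A ∈ Γ → D (A ∷ Γ) → D Γ
  contract-∈ {A = A} A∈Γ d with ys , zs , refl ← ∈-∃++ A∈Γ =
    exchange (↭-sym (shift A ys zs)) (contract (exchange (prep A (shift A ys zs)) d))

  contract-⊆ : ∀ E → E ⊆ Γ → D (E ++ Γ) → D Γ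
  contract-⊆ []      E⊆Γ d = d
  contract-⊆ (A ∷ E) E⊆Γ d = contract-⊆ E (E⊆Γ ∘ there) (contract-∈ (∈-++⁺ʳ E (E⊆Γ (here refl))) d)

  weaken-++ : ∀ E → D Γ → D (E ++ Γ)
  weaken-++ []      d = d
  weaken-++ (_ ∷ E) d = weaken (weaken-++ E d)

  weaken-⊆ : Γ ⊆ Δ → D Γ → D Δ
  weaken-⊆ {Γ = Γ} {Δ = Δ} Γ⊆Δ d = contract-⊆ Γ Γ⊆Δ (exchange (++-comm Δ Γ) (weaken-++ Δ d))

module LJₛ {V} {C : Formula V} = Structural (λ Γ → LJ Γ C) exch wl cl
module MLₛ {V} {P : Formula V → Set} {Δ Π} = Structural (λ Γ → ML P Γ Δ Π) (λ π → exch π ↭-refl) wl cl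

ML-body-in-P : {P : Formula V → Set} → ML P Γ Δ Π → All P Δ
ML-body-in-P ax            = []
ML-body-in-P (cut₁ d d')   = ++⁺ (ML-body-in-P d) (ML-body-in-P d')
ML-body-in-P (cut₂ d d')   = ++⁺ (tail (ML-body-in-P d)) (ML-body-in-P d')
ML-body-in-P (exch _ π d)  = All-resp-↭ π (ML-body-in-P d)
ML-body-in-P (der p d)     = p ∷ ML-body-in-P d
ML-body-in-P (cl d)        = ML-body-in-P d
ML-body-in-P (cr d)        = head (ML-body-in-P d) ∷ tail (tail (ML-body-in-P d))
ML-body-in-P (wl d)        = ML-body-in-P d
ML-body-in-P (wr p d)      = p ∷ ML-body-in-P d
ML-body-in-P (zl ps)       = ps
ML-body-in-P botl          = []
ML-body-in-P (∧l₁ _ _ d)   = ML-body-in-P d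
ML-body-in-P (∧l₂ d)       = ML-body-in-P d
ML-body-in-P (∧r₁ d d')    = ++⁺ (ML-body-in-P d) (ML-body-in-P d')
ML-body-in-P (∧r₂ d d')    = ++⁺ (tail (ML-body-in-P d)) (tail (ML-body-in-P d'))
ML-body-in-P (∧r₃ d d')    = ++⁺ (ML-body-in-P d) (tail (ML-body-in-P d'))
ML-body-in-P (∧r₄ d d')    = ++⁺ (tail (ML-body-in-P d)) (ML-body-in-P d')
ML-body-in-P (∨l₁ _ _ d _) = ML-body-in-P d
ML-body-in-P (∨l₂ d _)     = ML-body-in-P d
ML-body-in-P (∨r₁ d)       = ML-body-in-P d
ML-body-in-P (∨r₂ d)       = ML-body-in-P d
ML-body-in-P (∨r₃ d)       = tail (ML-body-in-P d)
ML-body-in-P (∨r₄ d)       = tail (ML-body-in-P d)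
ML-body-in-P (⇒l₁ _ d d')  = ++⁺ (ML-body-in-P d) (ML-body-in-P d')
ML-body-in-P (⇒l₂ d d')    = ++⁺ (ML-body-in-P d) (ML-body-in-P d')
ML-body-in-P (⇒l₃ d d')    = ++⁺ (ML-body-in-P d) (tail (ML-body-in-P d'))
ML-body-in-P (⇒r₁ d)       = ML-body-in-P d
ML-body-in-P (⇒r₂ d)       = tail (ML-body-in-P d)

-- Contexts are read as sets, and left rules keep their principal formula.
infix 3 _⊢ᶜᶠ_
data _⊢ᶜᶠ_ {V : Set} : Ctx V → Formula V → Set where
  hyp : A ∈ Γ → Γ ⊢ᶜᶠ A
  𝟎l  : 𝟎 ∈ Γ → Γ ⊢ᶜᶠ C
  ∧l  : (A ∧ B) ∈ Γ → A ∷ B ∷ Γ ⊢ᶜᶠ C → Γ ⊢ᶜᶠ C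
  ∨l  : (A ∨ B) ∈ Γ → A ∷ Γ ⊢ᶜᶠ C → B ∷ Γ ⊢ᶜᶠ C → Γ ⊢ᶜᶠ C
  ⇒l  : (A ⇒ B) ∈ Γ → Γ ⊢ᶜᶠ A → B ∷ Γ ⊢ᶜᶠ C → Γ ⊢ᶜᶠ C
  ∧r  : Γ ⊢ᶜᶠ A → Γ ⊢ᶜᶠ B → Γ ⊢ᶜᶠ A ∧ B
  ∨r₁ : Γ ⊢ᶜᶠ A → Γ ⊢ᶜᶠ A ∨ B
  ∨r₂ : Γ ⊢ᶜᶠ B → Γ ⊢ᶜᶠ A ∨ B
  ⇒r  : A ∷ Γ ⊢ᶜᶠ B → Γ ⊢ᶜᶠ A ⇒ B

Monotone : (Ctx V → Set) → Set
Monotone X = ∀ {W W'} → W ⊆ W' → X W → X W'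

⊢ᶜᶠ-mono : Monotone (_⊢ᶜᶠ C)
⊢ᶜᶠ-mono e (hyp p)      = hyp (e p)
⊢ᶜᶠ-mono e (𝟎l p)       = 𝟎l (e p)
⊢ᶜᶠ-mono e (∧l p d)     = ∧l (e p) (⊢ᶜᶠ-mono (∷⁺ʳ _ (∷⁺ʳ _ e)) d)
⊢ᶜᶠ-mono e (∨l p d d')  = ∨l (e p) (⊢ᶜᶠ-mono (∷⁺ʳ _ e) d) (⊢ᶜᶠ-mono (∷⁺ʳ _ e) d')
⊢ᶜᶠ-mono e (⇒l p d d')  = ⇒l (e p) (⊢ᶜᶠ-mono e d) (⊢ᶜᶠ-mono (∷⁺ʳ _ e) d')
⊢ᶜᶠ-mono e (∧r d d')    = ∧r (⊢ᶜᶠ-mono e d) (⊢ᶜᶠ-mono e d')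
⊢ᶜᶠ-mono e (∨r₁ d)      = ∨r₁ (⊢ᶜᶠ-mono e d)
⊢ᶜᶠ-mono e (∨r₂ d)      = ∨r₂ (⊢ᶜᶠ-mono e d)
⊢ᶜᶠ-mono e (⇒r d)       = ⇒r (⊢ᶜᶠ-mono (∷⁺ʳ _ e) d)

data Cover {V : Set} (X : Ctx V → Set) : Ctx V → Set where
  leaf : X W → Cover X W
  𝟎l   : 𝟎 ∈ W → Cover X W
  ∧l   : (A ∧ B) ∈ W → Cover X (A ∷ B ∷ W) → Cover X W
  ∨l   : (A ∨ B) ∈ W → Cover X (A ∷ W) → Cover X (B ∷ W) → Cover X W
  ⇒l   : (A ⇒ B) ∈ W → W ⊢ᶜᶠ A → Cover X (B ∷ W) → Cover X W

Glues : (Ctx V → Set) → Set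
Glues X = ∀ {W} → Cover X W → X W

Cover-mono : {X : Ctx V → Set} → Monotone X → Monotone (Cover X)
Cover-mono X-mono e (leaf x)     = leaf (X-mono e x)
Cover-mono X-mono e (𝟎l p)       = 𝟎l (e p)
Cover-mono X-mono e (∧l p c)     = ∧l (e p) (Cover-mono X-mono (∷⁺ʳ _ (∷⁺ʳ _ e)) c)
Cover-mono X-mono e (∨l p c c')  = ∨l (e p) (Cover-mono X-mono (∷⁺ʳ _ e) c) (Cover-mono X-mono (∷⁺ʳ _ e) c')
Cover-mono X-mono e (⇒l p d c)   = ⇒l (e p) (⊢ᶜᶠ-mono e d) (Cover-mono X-mono (∷⁺ʳ _ e) c)

Cover-map : {X Y : Ctx V → Set} → (∀ {W'} → W ⊆ W' → X W' → Y W') → Cover X W → Cover Y W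
Cover-map f (leaf x)    = leaf (f ⊆-refl x)
Cover-map f (𝟎l p)      = 𝟎l p
Cover-map f (∧l p c)    = ∧l p (Cover-map (λ e → f (e ∘ there ∘ there)) c)
Cover-map f (∨l p c c') = ∨l p (Cover-map (λ e → f (e ∘ there)) c) (Cover-map (λ e → f (e ∘ there)) c')
Cover-map f (⇒l p d c)  = ⇒l p d (Cover-map (λ e → f (e ∘ there)) c)

Cover-glues : {X : Ctx V → Set} → Glues (Cover X)
Cover-glues (leaf c)    = c
Cover-glues (𝟎l p)      = 𝟎l p
Cover-glues (∧l p c)    = ∧l p (Cover-glues c)
Cover-glues (∨l p c c') = ∨l p (Cover-glues c) (Cover-glues c')
Cover-glues (⇒l p d c)  = ⇒l p d (Cover-glues c)

⊢ᶜᶠ-glues : Glues (_⊢ᶜᶠ C)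
⊢ᶜᶠ-glues (leaf d)    = d
⊢ᶜᶠ-glues (𝟎l p)      = 𝟎l p
⊢ᶜᶠ-glues (∧l p c)    = ∧l p (⊢ᶜᶠ-glues c)
⊢ᶜᶠ-glues (∨l p c c') = ∨l p (⊢ᶜᶠ-glues c) (⊢ᶜᶠ-glues c')
⊢ᶜᶠ-glues (⇒l p d c)  = ⇒l p d (⊢ᶜᶠ-glues c)

-- W is refuted by left rules alone: this is the falsity of the model.
Inconsistent : Ctx V → Set
Inconsistent = Cover (λ _ → Empty)

Inconsistent⇒Cover : {X : Ctx V → Set} → Inconsistent W → Cover X W
Inconsistent⇒Cover = Cover-map (λ _ ())

¬ₖ_ : (Ctx V → Set) → Ctx V → Set
(¬ₖ X) W = ∀ {W'} → W ⊆ W' → X W' → Inconsistent W'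

¬¬ₖ_ : (Ctx V → Set) → Ctx V → Set
¬¬ₖ X = ¬ₖ (¬ₖ X)

¬ₖ-mono : {X : Ctx V → Set} → Monotone (¬ₖ X)
¬ₖ-mono e k e' = k (⊆-trans e e')

¬ₖ-glues : {X : Ctx V → Set} → Monotone X → Glues (¬ₖ X)
¬ₖ-glues X-mono c e x =
  Cover-glues (Cover-map (λ e' k → k ⊆-refl (X-mono e' x)) (Cover-mono ¬ₖ-mono e c))

¬¬ₖ-intro : {X : Ctx V → Set} → Monotone X → X W → (¬¬ₖ X) W
¬¬ₖ-intro X-mono x e k = k ⊆-refl (X-mono e x)

¬¬ₖ-elim : {X : Ctx V → Set} → (¬¬ₖ X) W → (¬ₖ X) W → Inconsistent W
¬¬ₖ-elim d k = d ⊆-refl k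

module Semantics (Q : Formula V → Set) where

  ⟦_⟧  : Formula V → Ctx V → Set
  -- The rules of ML_Q only decompose subformulas outside Q, so a subformula in Q
  -- is interpreted by its double negation alone.
  ⟦_⟧ᵖ : Formula V → Ctx V → Set
  ⟦ 𝟎 ⟧       = Inconsistent
  ⟦ ⊥ ⟧       = Inconsistent
  ⟦ var x ⟧ W = W ⊢ᶜᶠ var x
  ⟦ A ∧ B ⟧ W = ⟦ A ⟧ᵖ W × ⟦ B ⟧ᵖ W
  ⟦ A ∨ B ⟧   = Cover (λ W → ⟦ A ⟧ᵖ W ⊎ ⟦ B ⟧ᵖ W)
  ⟦ A ⇒ B ⟧ W = ∀ {W'} → W ⊆ W' → ⟦ A ⟧ W' → ⟦ B ⟧ᵖ W'
  ⟦ A ⟧ᵖ W    = (¬¬ₖ ⟦ A ⟧) W × (¬ Q A → ⟦ A ⟧ W)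

  ⟦⟧-mono  : ∀ A → Monotone ⟦ A ⟧
  ⟦⟧ᵖ-mono : ∀ A → Monotone ⟦ A ⟧ᵖ
  ⟦⟧-mono 𝟎       = Cover-mono λ _ ()
  ⟦⟧-mono ⊥       = Cover-mono λ _ ()
  ⟦⟧-mono (var x) = ⊢ᶜᶠ-mono
  ⟦⟧-mono (A ∧ B) e (a , b) = ⟦⟧ᵖ-mono A e a , ⟦⟧ᵖ-mono B e b
  ⟦⟧-mono (A ∨ B) = Cover-mono λ { e (inj₁ a) → inj₁ (⟦⟧ᵖ-mono A e a)
                                 ; e (inj₂ b) → inj₂ (⟦⟧ᵖ-mono B e b) }
  ⟦⟧-mono (A ⇒ B) e f e' = f (⊆-trans e e')
  ⟦⟧ᵖ-mono A e (a , a?) = ¬ₖ-mono e a , ⟦⟧-mono A e ∘ a?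

  ⟦⟧-glues  : ∀ A → Glues ⟦ A ⟧
  ⟦⟧ᵖ-glues : ∀ A → Glues ⟦ A ⟧ᵖ
  ⟦⟧-glues 𝟎       = Cover-glues
  ⟦⟧-glues ⊥       = Cover-glues
  ⟦⟧-glues (var x) = ⊢ᶜᶠ-glues
  ⟦⟧-glues (A ∧ B) c = ⟦⟧ᵖ-glues A (Cover-map (λ _ → proj₁) c) , ⟦⟧ᵖ-glues B (Cover-map (λ _ → proj₂) c)
  ⟦⟧-glues (A ∨ B) = Cover-glues
  ⟦⟧-glues (A ⇒ B) c e a =
    ⟦⟧ᵖ-glues B (Cover-map (λ e' f → f ⊆-refl (⟦⟧-mono A e' a)) (Cover-mono (⟦⟧-mono (A ⇒ B)) e c))
  ⟦⟧ᵖ-glues A c =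
    ¬ₖ-glues ¬ₖ-mono (Cover-map (λ _ → proj₁) c) , λ A∉Q → ⟦⟧-glues A (Cover-map (λ _ a → proj₂ a A∉Q) c)

  ⟦⟧ᵖ-intro : ∀ A → ⟦ A ⟧ W → ⟦ A ⟧ᵖ W
  ⟦⟧ᵖ-intro A a = ¬¬ₖ-intro (⟦⟧-mono A) a , λ _ → a

  ⟦⟧ᵖ-classical : ∀ A → Q A → (¬¬ₖ ⟦ A ⟧) W → ⟦ A ⟧ᵖ W
  ⟦⟧ᵖ-classical A A∈Q a = a , λ A∉Q → ⊥-elim (A∉Q A∈Q)

  ⟦_⟧ᶜ : Ctx V → Ctx V → Set
  ⟦ Γ ⟧ᶜ W = All (λ A → ⟦ A ⟧ W) Γ

  ⟦⟧ᶜ-mono : Monotone ⟦ Γ ⟧ᶜ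
  ⟦⟧ᶜ-mono e = All.map (λ {A} → ⟦⟧-mono A e)

  Refutations : Ctx V → Ctx V → Set
  Refutations Δ W = All (λ A → (¬ₖ ⟦ A ⟧) W) Δ

  Refutations-mono : Monotone (Refutations Δ)
  Refutations-mono e = All.map (λ {A} → ¬ₖ-mono e)

  ⟦_⟧ˢ : Maybe (Formula V) → Ctx V → Set
  ⟦ just C ⟧ˢ = ⟦ C ⟧
  ⟦ nothing ⟧ˢ = Inconsistent

  ⟦⟧ˢ-absurd : ∀ Π → Inconsistent W → ⟦ Π ⟧ˢ W
  ⟦⟧ˢ-absurd (just C) r = ⟦⟧-glues C (Inconsistent⇒Cover r)
  ⟦⟧ˢ-absurd nothing  r = r

  sound         : ML Q Γ Δ Π → ⟦ Γ ⟧ᶜ W → Refutations Δ W → ⟦ Π ⟧ˢ W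
  sound-refutes : ML Q (A ∷ Γ) Δ nothing → ⟦ Γ ⟧ᶜ W → Refutations Δ W → (¬ₖ ⟦ A ⟧) W
  -- The head of a body lies in Q, so its double negation is all that is needed.
  sound-body    : ML Q Γ (A ∷ Δ) nothing → ⟦ Γ ⟧ᶜ W → Refutations Δ W → ⟦ A ⟧ᵖ W

  sound-refutes d γ δ e a = sound d (a ∷ ⟦⟧ᶜ-mono e γ) (Refutations-mono e δ)
  sound-body {A = A} d γ δ =
    ⟦⟧ᵖ-classical A (head (ML-body-in-P d)) λ e k → sound d (⟦⟧ᶜ-mono e γ) (k ∷ Refutations-mono e δ)

  sound ax (a ∷ []) [] = a
  sound (cut₁ {Γ = Γ} {Δ = Δ} d d') γ δ =
    let γ₁ , γ₂ = ++⁻ Γ γ ; δ₁ , δ₂ = ++⁻ Δ δ in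
    sound d' (sound d γ₁ δ₁ ∷ γ₂) δ₂
  sound (cut₂ {Γ = Γ} {Δ = Δ} d d') γ δ =
    let γ₁ , γ₂ = ++⁻ Γ γ ; δ₁ , δ₂ = ++⁻ Δ δ in
    sound d γ₁ (sound-refutes d' γ₂ δ₂ ∷ δ₁)
  sound (exch π π' d) γ δ = sound d (All-resp-↭ (↭-sym π) γ) (All-resp-↭ (↭-sym π') δ)
  sound (der _ d) γ (k ∷ δ) = k ⊆-refl (sound d γ δ)
  sound (cl d) (a ∷ γ) δ = sound d (a ∷ a ∷ γ) δ
  sound (cr d) γ (k ∷ δ) = sound d γ (k ∷ k ∷ δ)
  sound (wl d) (_ ∷ γ) δ = sound d γ δ
  sound (wr _ d) γ (_ ∷ δ) = sound d γ δ
  sound (zl {Π = Π} _) (r ∷ _) _ = ⟦⟧ˢ-absurd Π r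
  sound botl (r ∷ []) [] = r
  sound (∧l₁ A∉Q B∉Q d) ((a , b) ∷ γ) δ = sound d (proj₂ a A∉Q ∷ proj₂ b B∉Q ∷ γ) δ
  sound (∧l₂ d) ((a , b) ∷ γ) δ =
    ¬¬ₖ-elim (proj₁ b) λ e y → proj₁ a e (sound-refutes d (y ∷ ⟦⟧ᶜ-mono e γ) (Refutations-mono e δ))
  sound (∧r₁ {Γ = Γ} {Δ = Δ} {A = A} {B = B} d d') γ δ =
    let γ₁ , γ₂ = ++⁻ Γ γ ; δ₁ , δ₂ = ++⁻ Δ δ in
    ⟦⟧ᵖ-intro A (sound d γ₁ δ₁) , ⟦⟧ᵖ-intro B (sound d' γ₂ δ₂)
  sound (∧r₂ {Γ = Γ} {Δ = Δ} d d') γ δ =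
    let γ₁ , γ₂ = ++⁻ Γ γ ; δ₁ , δ₂ = ++⁻ Δ δ in
    sound-body d γ₁ δ₁ , sound-body d' γ₂ δ₂
  sound (∧r₃ {Γ = Γ} {Δ = Δ} {A = A} d d') γ δ =
    let γ₁ , γ₂ = ++⁻ Γ γ ; δ₁ , δ₂ = ++⁻ Δ δ in
    ⟦⟧ᵖ-intro A (sound d γ₁ δ₁) , sound-body d' γ₂ δ₂
  sound (∧r₄ {Γ = Γ} {Δ = Δ} {B = B} d d') γ δ =
    let γ₁ , γ₂ = ++⁻ Γ γ ; δ₁ , δ₂ = ++⁻ Δ δ in
    sound-body d γ₁ δ₁ , ⟦⟧ᵖ-intro B (sound d' γ₂ δ₂)
  sound (∨l₁ {C = C} A∉Q B∉Q d d') (c ∷ γ) δ =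
    ⟦⟧-glues C (Cover-map (λ { e (inj₁ a) → sound d  (proj₂ a A∉Q ∷ ⟦⟧ᶜ-mono e γ) (Refutations-mono e δ)
                             ; e (inj₂ b) → sound d' (proj₂ b B∉Q ∷ ⟦⟧ᶜ-mono e γ) (Refutations-mono e δ) }) c)
  sound (∨l₂ d d') (c ∷ γ) δ =
    Cover-glues (Cover-map (λ { e (inj₁ a) → ¬¬ₖ-elim (proj₁ a) (sound-refutes d  (⟦⟧ᶜ-mono e γ) (Refutations-mono e δ))
                              ; e (inj₂ b) → ¬¬ₖ-elim (proj₁ b) (sound-refutes d' (⟦⟧ᶜ-mono e γ) (Refutations-mono e δ)) }) c)
  sound (∨r₁ {A = A} d) γ δ = leaf (inj₁ (⟦⟧ᵖ-intro A (sound d γ δ)))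
  sound (∨r₂ {B = B} d) γ δ = leaf (inj₂ (⟦⟧ᵖ-intro B (sound d γ δ)))
  sound (∨r₃ d) γ δ = leaf (inj₁ (sound-body d γ δ))
  sound (∨r₄ d) γ δ = leaf (inj₂ (sound-body d γ δ))
  sound (⇒l₁ {Γ = Γ} {Δ = Δ} B∉Q d d') (f ∷ γ) δ =
    let γ₁ , γ₂ = ++⁻ Γ γ ; δ₁ , δ₂ = ++⁻ Δ δ in
    sound d (proj₂ (f ⊆-refl (sound d' γ₂ δ₂)) B∉Q ∷ γ₁) δ₁
  sound (⇒l₂ {Γ = Γ} {Δ = Δ} d d') (f ∷ γ) δ =
    let γ₁ , γ₂ = ++⁻ Γ γ ; δ₁ , δ₂ = ++⁻ Δ δ in
    ¬¬ₖ-elim (proj₁ (f ⊆-refl (sound d' γ₂ δ₂))) (sound-refutes d γ₁ δ₁)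
  sound (⇒l₃ {Γ = Γ} {Δ = Δ} d d') (f ∷ γ) δ =
    let γ₁ , γ₂ = ++⁻ Γ γ ; δ₁ , δ₂ = ++⁻ Δ δ in
    sound d' γ₂ ((λ e a → ¬¬ₖ-elim (proj₁ (f e a)) (sound-refutes d (⟦⟧ᶜ-mono e γ₁) (Refutations-mono e δ₁))) ∷ δ₂)
  sound (⇒r₁ {B = B} d) γ δ e a = ⟦⟧ᵖ-intro B (sound d (a ∷ ⟦⟧ᶜ-mono e γ) (Refutations-mono e δ))
  sound (⇒r₂ d) γ δ e a = sound-body d (a ∷ ⟦⟧ᶜ-mono e γ) (Refutations-mono e δ)

stable-∧ : {S : Formula V → Set} → Stable S → S (A ∧ B) → S A × S B
stable-∧ (S-∧ , _) = S-∧

stable-∨ : {S : Formula V → Set} → Stable S → S (A ∨ B) → S A × S B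
stable-∨ (_ , S-∨ , _) = S-∨

stable-⇒ : {S : Formula V → Set} → Stable S → S (A ⇒ B) → S A × S B
stable-⇒ (_ , _ , S-⇒) = S-⇒

module Normalisation (Q I : Formula V → Set) (I-stable : Stable I)
  (I∩Q=∅ : ∀ A → I A → ¬ Q A) (⊥∉I : ¬ I ⊥) where

  open Semantics Q

  reify    : ∀ A → I A → ⟦ A ⟧ W → W ⊢ᶜᶠ A
  reifyᵖ   : ∀ A → I A → ⟦ A ⟧ᵖ W → W ⊢ᶜᶠ A
  reflect  : ∀ A → I A → A ∈ W → ⟦ A ⟧ W
  reflectᵖ : ∀ A → I A → A ∈ W → ⟦ A ⟧ᵖ W

  reifyᵖ A IA a = reify A IA (proj₂ a (I∩Q=∅ A IA))
  reflectᵖ A IA p = ⟦⟧ᵖ-intro A (reflect A IA p)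

  reify 𝟎 _ r = ⊢ᶜᶠ-glues (Inconsistent⇒Cover r)
  reify ⊥ I⊥ _ = ⊥-elim (⊥∉I I⊥)
  reify (var x) _ d = d
  reify (A ∧ B) IA∧B (a , b) =
    let IA , IB = stable-∧ I-stable IA∧B in ∧r (reifyᵖ A IA a) (reifyᵖ B IB b)
  reify (A ∨ B) IA∨B c =
    let IA , IB = stable-∨ I-stable IA∨B in
    ⊢ᶜᶠ-glues (Cover-map (λ { _ (inj₁ a) → ∨r₁ (reifyᵖ A IA a) ; _ (inj₂ b) → ∨r₂ (reifyᵖ B IB b) }) c)
  reify (A ⇒ B) IA⇒B f =
    let IA , IB = stable-⇒ I-stable IA⇒B in ⇒r (reifyᵖ B IB (f (xs⊆x∷xs _ A) (reflect A IA (here refl))))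

  reflect 𝟎 _ p = 𝟎l p
  reflect ⊥ I⊥ _ = ⊥-elim (⊥∉I I⊥)
  reflect (var x) _ p = hyp p
  reflect (A ∧ B) IA∧B p =
    let IA , IB = stable-∧ I-stable IA∧B in
    ⟦⟧-glues (A ∧ B) (∧l p (leaf (reflectᵖ A IA (here refl) , reflectᵖ B IB (there (here refl)))))
  reflect (A ∨ B) IA∨B p =
    let IA , IB = stable-∨ I-stable IA∨B in
    ∨l p (leaf (inj₁ (reflectᵖ A IA (here refl)))) (leaf (inj₂ (reflectᵖ B IB (here refl))))
  reflect (A ⇒ B) IA⇒B p e a =
    let IA , IB = stable-⇒ I-stable IA⇒B in
    ⟦⟧ᵖ-glues B (⇒l (e p) (reify A IA a) (leaf (reflectᵖ B IB (here refl))))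

  normalise : All I Γ → I A → ML Q Γ [] (just A) → Γ ⊢ᶜᶠ A
  normalise {A = A} IΓ IA d = reify A IA (sound d (tabulate λ p → reflect _ (lookup IΓ p) p) [])

LJ-∧l : LJ (A ∷ B ∷ Γ) C → LJ ((A ∧ B) ∷ Γ) C
LJ-∧l {A = A} {B = B} d =
  cl (∧l₁ (exch (swap (A ∧ B) A ↭-refl) (∧l₂ (exch (swap A B ↭-refl) d))))

⊢ᶜᶠ⇒LJ : Γ ⊢ᶜᶠ C → LJ Γ C
⊢ᶜᶠ⇒LJ (hyp p)                    = LJₛ.weaken-⊆ (∈-∷⁺ʳ p λ ()) ax
⊢ᶜᶠ⇒LJ (𝟎l p)                     = LJₛ.contract-∈ p zl
⊢ᶜᶠ⇒LJ (∧l p d)                   = LJₛ.contract-∈ p (LJ-∧l (⊢ᶜᶠ⇒LJ d))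
⊢ᶜᶠ⇒LJ (∨l p d d')                = LJₛ.contract-∈ p (∨l (⊢ᶜᶠ⇒LJ d) (⊢ᶜᶠ⇒LJ d'))
⊢ᶜᶠ⇒LJ {Γ = Γ} (⇒l {A = A} {B = B} p d d') =
  LJₛ.contract-⊆ ((A ⇒ B) ∷ Γ) (∈-∷⁺ʳ p ⊆-refl) (⇒l (⊢ᶜᶠ⇒LJ d) (⊢ᶜᶠ⇒LJ d'))
⊢ᶜᶠ⇒LJ (∧r d d')                  = ∧r (⊢ᶜᶠ⇒LJ d) (⊢ᶜᶠ⇒LJ d')
⊢ᶜᶠ⇒LJ (∨r₁ d)                    = ∨r₁ (⊢ᶜᶠ⇒LJ d)
⊢ᶜᶠ⇒LJ (∨r₂ d)                    = ∨r₂ (⊢ᶜᶠ⇒LJ d)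
⊢ᶜᶠ⇒LJ (⇒r d)                     = ⇒r (⊢ᶜᶠ⇒LJ d)

module _ {P I : Formula V → Set} (I-stable : Stable I) (I∩P=∅ : ∀ A → I A → ¬ P A) where

  ⊢ᶜᶠ⇒ML : All I Γ → I C → Γ ⊢ᶜᶠ C → ML P Γ [] (just C)
  ⊢ᶜᶠ⇒ML IΓ IC (hyp p) = MLₛ.weaken-⊆ (∈-∷⁺ʳ p λ ()) ax
  ⊢ᶜᶠ⇒ML IΓ IC (𝟎l p)  = MLₛ.contract-∈ p (zl [])
  ⊢ᶜᶠ⇒ML IΓ IC (∧l {A = A} {B = B} p d) =
    let IA , IB = stable-∧ I-stable (lookup IΓ p) in
    MLₛ.contract-∈ p (∧l₁ (I∩P=∅ A IA) (I∩P=∅ B IB) (⊢ᶜᶠ⇒ML (IA ∷ IB ∷ IΓ) IC d))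
  ⊢ᶜᶠ⇒ML IΓ IC (∨l {A = A} {B = B} p d d') =
    let IA , IB = stable-∨ I-stable (lookup IΓ p) in
    MLₛ.contract-∈ p (∨l₁ (I∩P=∅ A IA) (I∩P=∅ B IB) (⊢ᶜᶠ⇒ML (IA ∷ IΓ) IC d) (⊢ᶜᶠ⇒ML (IB ∷ IΓ) IC d'))
  ⊢ᶜᶠ⇒ML {Γ = Γ} IΓ IC (⇒l {A = A} {B = B} p d d') =
    let IA , IB = stable-⇒ I-stable (lookup IΓ p) in
    MLₛ.contract-⊆ ((A ⇒ B) ∷ Γ) (∈-∷⁺ʳ p ⊆-refl)
      (⇒l₁ (I∩P=∅ B IB) (⊢ᶜᶠ⇒ML (IB ∷ IΓ) IC d') (⊢ᶜᶠ⇒ML IΓ IA d))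
  ⊢ᶜᶠ⇒ML {Γ = Γ} IΓ IC (∧r d d') =
    let IA , IB = stable-∧ I-stable IC in
    MLₛ.contract-⊆ Γ ⊆-refl (∧r₁ (⊢ᶜᶠ⇒ML IΓ IA d) (⊢ᶜᶠ⇒ML IΓ IB d'))
  ⊢ᶜᶠ⇒ML IΓ IC (∨r₁ d) = ∨r₁ (⊢ᶜᶠ⇒ML IΓ (proj₁ (stable-∨ I-stable IC)) d)
  ⊢ᶜᶠ⇒ML IΓ IC (∨r₂ d) = ∨r₂ (⊢ᶜᶠ⇒ML IΓ (proj₂ (stable-∨ I-stable IC)) d)
  ⊢ᶜᶠ⇒ML IΓ IC (⇒r d) =
    let IA , IB = stable-⇒ I-stable IC in ⇒r₁ (⊢ᶜᶠ⇒ML (IA ∷ IΓ) IB d)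

LJ⇒ML∅ : LJ Γ C → ML ∅ Γ [] (just C)
LJ⇒ML∅ ax = ax
LJ⇒ML∅ (cut _ d d') = cut₁ (LJ⇒ML∅ d) (LJ⇒ML∅ d')
LJ⇒ML∅ (exch π d) = exch π ↭-refl (LJ⇒ML∅ d)
LJ⇒ML∅ (wl d) = wl (LJ⇒ML∅ d)
LJ⇒ML∅ (cl d) = cl (LJ⇒ML∅ d)
LJ⇒ML∅ zl = zl []
LJ⇒ML∅ (∧l₁ {Γ = Γ} {A = A} {B = B} d) =
  ∧l₁ (λ ()) (λ ()) (MLₛ.weaken-⊆ (∷⁺ʳ A (xs⊆x∷xs Γ B)) (LJ⇒ML∅ d))
LJ⇒ML∅ (∧l₂ d) = ∧l₁ (λ ()) (λ ()) (wl (LJ⇒ML∅ d))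
LJ⇒ML∅ {Γ = Γ} (∧r d d') = MLₛ.contract-⊆ Γ ⊆-refl (∧r₁ (LJ⇒ML∅ d) (LJ⇒ML∅ d'))
LJ⇒ML∅ (∨l d d') = ∨l₁ (λ ()) (λ ()) (LJ⇒ML∅ d) (LJ⇒ML∅ d')
LJ⇒ML∅ (∨r₁ d) = ∨r₁ (LJ⇒ML∅ d)
LJ⇒ML∅ (∨r₂ d) = ∨r₂ (LJ⇒ML∅ d)
LJ⇒ML∅ (⇒l {Γ = Γ} {Γ' = Γ'} d d') = exch (prep _ (++-comm Γ' Γ)) ↭-refl (⇒l₁ (λ ()) (LJ⇒ML∅ d') (LJ⇒ML∅ d))
LJ⇒ML∅ (⇒r d) = ⇒r₁ (LJ⇒ML∅ d)

theorem4p4 : {V : Set} (P I : Formula V → Set) → Stable I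
             → (∀ A → I A → ¬ P A) → ¬ I ⊥
             → (Γ : List (Formula V)) (A : Formula V) → All I Γ → I A
             → ML P Γ [] (just A) ⇔ LJ Γ A
theorem4p4 P I I-stable I∩P=∅ ⊥∉I Γ A IΓ IA = mk⇔
  (⊢ᶜᶠ⇒LJ ∘ NormP.normalise IΓ IA)
  (⊢ᶜᶠ⇒ML I-stable I∩P=∅ IΓ IA ∘ Norm∅.normalise IΓ IA ∘ LJ⇒ML∅)
  where
  module NormP = Normalisation P I I-stable I∩P=∅ ⊥∉I
  module Norm∅ = Normalisation ∅ I I-stable (λ _ _ ()) ⊥∉I
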